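{- Let $G$ be a finite non-abelian nilpotent group such that $|G|$ has exactly two distinct prime divisors. Then there is no graph $\Gamma$ such that $\mathcal{P}^{**}(G)=L(\Gamma)$.
   Context: For a finite group $G$, the power graph $\mathcal{P}(G)$ is the simple graph with vertex set $G$ in which two distinct vertices $u,v$ are adjacent iff $u^m=v$ or $v^n=u$ for some positive integers $m,n$. The proper power graph $\mathcal{P}^{**}(G)$ is obtained from $\mathcal{P}(G)$ by deleting all dominating vertices (vertices adjacent to all other vertices). $L(\Gamma)$ is the line graph of $\Gamma$: vertices are edges of $\Gamma$, adjacent iff they share an endpoint. -}

module Defs where

open import Data.Nat using (ℕ; zero; suc; _<_)
open import Data.Nat.Divisibility using (_∣_)
open import Data.Nat.Primality using (Prime)
open import Data.Fin using (Fin; toℕ)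
open import Data.Bool using (Bool; true)
open import Data.Product using (Σ; ∃; ∃-syntax; _×_; _,_; proj₁; proj₂)
open import Data.Sum using (_⊎_)
open import Data.Empty using (⊥)
open import Relation.Nullary using (¬_)
open import Relation.Binary.PropositionalEquality using (_≡_; _≢_)
open import Function.Bundles using (_⇔_)

-- Finite groups, presented on the carrier Fin n (every finite group is
-- isomorphic to one of these); the order of the group is n.

record FinGroup : Set where
  field
    n     : ℕ
    _·_   : Fin n → Fin n → Fin n
    e     : Fin n
    inv   : Fin n → Fin n
    assoc : ∀ x y z → (x · y) · z ≡ x · (y · z)
    idˡ   : ∀ x → e · x ≡ x
    idʳ   : ∀ x → x · e ≡ x
    invˡ  : ∀ x → inv x · x ≡ e
    invʳ  : ∀ x → x · inv x ≡ e

  pow : Fin n → ℕ → Fin n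
  pow x zero    = e
  pow x (suc k) = x · pow x k

  comm : Fin n → Fin n → Fin n
  comm g x = ((g · x) · inv g) · inv x

  Z : ℕ → Fin n → Set
  Z zero    g = g ≡ e
  Z (suc i) g = ∀ x → Z i (comm g x)

open FinGroup public

IsAbelian : FinGroup → Set
IsAbelian G = ∀ x y → _·_ G x y ≡ _·_ G y x

IsNilpotent : FinGroup → Set
IsNilpotent G = ∃[ k ] (∀ g → Z G k g)

HasExactlyTwoPrimeDivisors : ℕ → Set
HasExactlyTwoPrimeDivisors m =
  ∃[ p ] ∃[ q ] (p ≢ q × Prime p × Prime q × p ∣ m × q ∣ m ×
    (∀ r → Prime r → r ∣ m → r ≡ p ⊎ r ≡ q))

record Graph : Set₁ where
  field
    V   : Set
    _≈_ : V → V → Set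
    Adj : V → V → Set

open Graph public

record _≅_ (A B : Graph) : Set where
  field
    to      : V A → V B
    from    : V B → V A
    to-cong : ∀ x y → _≈_ A x y → _≈_ B (to x) (to y)
    from-cong : ∀ x y → _≈_ B x y → _≈_ A (from x) (from y)
    from∘to : ∀ x → _≈_ A (from (to x)) x
    to∘from : ∀ y → _≈_ B (to (from y)) y
    adj     : ∀ x y → Adj A x y ⇔ Adj B (to x) (to y)

PowAdj : (G : FinGroup) → Fin (n G) → Fin (n G) → Set
PowAdj G u v = u ≢ v × ((∃[ m ] pow G u (suc m) ≡ v) ⊎ (∃[ m ] pow G v (suc m) ≡ u))

Dominating : (G : FinGroup) → Fin (n G) → Set
Dominating G u = ∀ v → u ≢ v → PowAdj G u v

ProperPowerGraph : FinGroup → Graph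
ProperPowerGraph G = record
  { V   = Σ (Fin (n G)) (λ u → ¬ Dominating G u)
  ; _≈_ = λ x y → proj₁ x ≡ proj₁ y
  ; Adj = λ x y → PowAdj G (proj₁ x) (proj₁ y)
  }

record SimpleGraph (m : ℕ) : Set where
  field
    E     : Fin m → Fin m → Bool
    sym   : ∀ i j → E i j ≡ E j i
    irrefl : ∀ i → E i i ≡ true → ⊥

open SimpleGraph public

-- an edge {i,j} is represented as the pair (i , j) with i < j
Edge : ∀ {m} → SimpleGraph m → Set
Edge {m} Γ = Σ (Fin m × Fin m) (λ p → toℕ (proj₁ p) < toℕ (proj₂ p) × E Γ (proj₁ p) (proj₂ p) ≡ true)

ShareEndpoint : ∀ {m} → (Fin m × Fin m) → (Fin m × Fin m) → Set
ShareEndpoint (a , b) (c , d) = a ≡ c ⊎ a ≡ d ⊎ b ≡ c ⊎ b ≡ d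

LineGraph : ∀ {m} → SimpleGraph m → Graph
LineGraph Γ = record
  { V   = Edge Γ
  ; _≈_ = λ x y → proj₁ x ≡ proj₁ y
  ; Adj = λ x y → proj₁ x ≢ proj₁ y × ShareEndpoint (proj₁ x) (proj₁ y)
  }

module Submission where

open import Defs using (FinGroup; n; IsNilpotent; IsAbelian; HasExactlyTwoPrimeDivisors; Graph; V; _≈_; Adj;
  PowAdj; Dominating; ProperPowerGraph; _≅_; SimpleGraph; ShareEndpoint; LineGraph)
open import Algebra.Bundles using (Group)
import Algebra.Properties.Group as GroupProperties
open import Data.Bool using (Bool; true; false; not)
import Data.Bool.Properties as Bool
open import Data.Empty using (⊥; ⊥-elim)
open import Data.Fin using (Fin; zero; suc; toℕ) renaming (_<_ to _<ᶠ_)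
open import Data.Fin.Patterns using (0F; 1F; 2F)
import Data.Fin.Properties as Fin
open import Data.List using (List; []; _∷_; _++_; _∷ʳ_; map; concatMap; length; replicate; allFin)
import Data.List.Properties as List
open import Data.Nat using (ℕ; zero; suc; 2+; _+_; _*_; _∸_; _^_; _≤_; _<_; z≤n; s≤s; z<s; s<s; NonZero;
  pred; nonTrivial⇒n>1; ≢-nonZero; >-nonZero)
import Data.Nat as ℕ
open import Data.Nat.Properties
open import Data.Nat.Coprimality using (Coprime; ¬0-coprimeTo-2+; coprime-Bézout; coprime-divisor; prime⇒coprime)
import Data.Nat.Coprimality as Coprimality
open import Data.Nat.Divisibility using (_∣_; _∣0; _∣?_; ∣-refl; ∣-trans; ∣1⇒≡1; ∣m∣n⇒∣m+n; ∣m+n∣m⇒∣n; ∣m⇒∣m*n;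
  quotient≢0; quotient-<; m∣n⇒n≡m*quotient)
open import Data.Nat.GCD using (module Bézout)
open import Data.Nat.Induction using (<-rec)
open import Data.Nat.Primality using (Prime; prime⇒irreducible; prime⇒nonTrivial; prime⇒nonZero)
open import Data.Nat.Tactic.RingSolver using (solve-∀)
open import Data.Product using (∃; ∃₂; ∃-syntax; _×_; _,_; proj₁; proj₂)
open import Data.Sum using (_⊎_; inj₁; inj₂)
open import Data.Vec using (Vec; []; _∷_; lookup)
open import Function using (_∘_; case_of_)
open import Function.Bundles using (Equivalence)
open import Level using (0ℓ)
open import Relation.Binary using (IsEquivalence; DecidableEquality; tri<; tri≈; tri>)
import Relation.Binary.Construct.On as On
open import Relation.Binary.PropositionalEquality
open import Relation.Nullary using (¬_; Dec; yes; no; contradiction)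
open import Relation.Nullary.Decidable using (_×-dec_; ¬?)
open import Relation.Unary using (Decidable)

-- Take non-commuting x and z and split each into its q-part and q′-part. In a nilpotent group elements of
-- coprime orders commute (the commutator descends the upper central series), so either the q′-parts or the
-- q-parts fail to commute. This yields a prime s ∈ {q, p} and non-commuting a, b of orders prime to s;
-- the s′-part c of a·b commutes with neither. Cauchy's theorem gives y of order s, which commutes with a,
-- b, c, and y is a power of each of a·y, b·y, c·y, while none of these three is a power of another. So y,
-- a·y, b·y, c·y form an induced claw in P**(G), and line graphs are claw-free.

-- Arithmetic

prime>1 : ∀ {p} → Prime p → 1 < p
prime>1 p-prime = nonTrivial⇒n>1 _ {{prime⇒nonTrivial p-prime}}

coprime⇒bézout : ∀ {a b} .{{_ : NonZero a}} → Coprime a b → ∃₂ λ u w → a * u ≡ 1 + b * w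
coprime⇒bézout {a} {b} a⊥b with coprime-Bézout a⊥b
... | Bézout.+- x y eq = x , y , trans (*-comm a x) (trans (sym eq) (cong suc (*-comm y b)))
coprime⇒bézout {suc a} {0}   a⊥b | Bézout.-+ x y eq = contradiction (trans eq (*-zeroʳ y)) λ ()
coprime⇒bézout {suc a} {1}   a⊥b | Bézout.-+ x y eq = 1 , a , cong suc (trans (*-identityʳ a) (sym (+-identityʳ a)))
coprime⇒bézout {a} {2+ b} a⊥b | Bézout.-+ x 0       eq = contradiction eq λ ()
coprime⇒bézout {a} {2+ b} a⊥b | Bézout.-+ x (suc y) eq =
  x * suc b , b + suc b * y , +-cancelˡ-≡ (suc b) _ _ (begin
    suc b + a * (x * suc b)               ≡⟨ factor a b x ⟩
    suc b * (1 + x * a)                   ≡⟨ cong (suc b *_) eq ⟩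
    suc b * (suc y * 2+ b)                ≡⟨ expand b y ⟩
    suc b + (1 + 2+ b * (b + suc b * y))  ∎)
  where
  open ≡-Reasoning
  factor : ∀ a b x → suc b + a * (x * suc b) ≡ suc b * (1 + x * a)
  factor = solve-∀
  expand : ∀ b y → suc b * (suc y * 2+ b) ≡ suc b + (1 + 2+ b * (b + suc b * y))
  expand = solve-∀

prime∤⇒coprime : ∀ {p m} → Prime p → ¬ p ∣ m → Coprime p m
prime∤⇒coprime p-prime p∤m (d∣p , d∣m) with prime⇒irreducible p-prime d∣p
... | inj₁ d≡1 = d≡1
... | inj₂ refl = contradiction d∣m p∤m

coprime-*ˡ : ∀ {a b c} → Coprime a c → Coprime b c → Coprime (a * b) c
coprime-*ˡ a⊥c b⊥c (d∣ab , d∣c) =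
  b⊥c (coprime-divisor (λ (e∣d , e∣a) → a⊥c (e∣a , ∣-trans e∣d d∣c)) d∣ab , d∣c)

coprime-^ˡ : ∀ {a c} → Coprime a c → ∀ k → Coprime (a ^ k) c
coprime-^ˡ a⊥c zero    (d∣1 , _) = ∣1⇒≡1 d∣1
coprime-^ˡ a⊥c (suc k) = coprime-*ˡ a⊥c (coprime-^ˡ a⊥c k)

primePowerSplit : ∀ {p} → Prime p → ∀ m → .{{NonZero m}} → ∃₂ λ α r → m ≡ p ^ α * r × ¬ p ∣ r
primePowerSplit {p} p-prime = <-rec _ split
  where
  instance _ = prime⇒nonTrivial p-prime
  split : ∀ m → (∀ {k} → k < m → .{{NonZero k}} → ∃₂ λ α r → k ≡ p ^ α * r × ¬ p ∣ r) →
          .{{NonZero m}} → ∃₂ λ α r → m ≡ p ^ α * r × ¬ p ∣ r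
  split m rec with p ∣? m
  ... | no p∤m = 0 , m , sym (+-identityʳ m) , p∤m
  ... | yes p∣m with rec (quotient-< p∣m) {{quotient≢0 p∣m}}
  ...   | α , r , m/p≡pᵅr , p∤r =
    suc α , r , trans (m∣n⇒n≡m*quotient p∣m) (trans (cong (p *_) m/p≡pᵅr) (sym (*-assoc p (p ^ α) r))) , p∤r

∤⇒nonZero : ∀ {p m} → ¬ p ∣ m → NonZero m
∤⇒nonZero {p} p∤m = ≢-nonZero λ { refl → p∤m (p ∣0) }

distinctPrimes⇒coprime : ∀ {p q} → Prime p → Prime q → p ≢ q → Coprime p q
distinctPrimes⇒coprime p-prime q-prime p≢q = prime∤⇒coprime p-prime λ p∣q → case prime⇒irreducible q-prime p∣q of λ
  { (inj₁ p≡1) → <-irrefl (sym p≡1) (prime>1 p-prime)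
  ; (inj₂ p≡q) → p≢q p≡q
  }

coprime-prime⇒nonZero : ∀ {m p} → Prime p → Coprime m p → NonZero m
coprime-prime⇒nonZero {zero}  p-prime 0⊥p = ⊥-elim (¬0-coprimeTo-2+ {{prime⇒nonTrivial p-prime}} 0⊥p)
coprime-prime⇒nonZero {suc m} _       _   = _

-- Counting

private variable
  A B : Set
  P Q : Set

𝟙 : Dec P → ℕ
𝟙 (yes _) = 1
𝟙 (no _)  = 0

𝟙-no : (P? : Dec P) → ¬ P → 𝟙 P? ≡ 0
𝟙-no (yes p) ¬p = contradiction p ¬p
𝟙-no (no _)  _  = refl

𝟙≤1 : (P? : Dec P) → 𝟙 P? ≤ 1
𝟙≤1 (yes _) = ≤-refl
𝟙≤1 (no _)  = z≤n

𝟙>0⇒ : (P? : Dec P) → 0 < 𝟙 P? → P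
𝟙>0⇒ (yes p) _ = p

𝟙-cong : (P? : Dec P) (Q? : Dec Q) → (P → Q) → (Q → P) → 𝟙 P? ≡ 𝟙 Q?
𝟙-cong P? Q? P→Q Q→P with P? | Q?
... | yes _ | yes _ = refl
... | yes p | no ¬q = contradiction (P→Q p) ¬q
... | no ¬p | yes q = contradiction (Q→P q) ¬p
... | no _  | no _  = refl

𝟙-split : (P? : Dec P) (Q? : Dec Q) → 𝟙 P? ≡ 𝟙 (P? ×-dec ¬? Q?) + 𝟙 (P? ×-dec Q?)
𝟙-split (yes _) (yes _) = refl
𝟙-split (yes _) (no _)  = refl
𝟙-split (no _)  (yes _) = refl
𝟙-split (no _)  (no _)  = refl

𝟙-×-yes : (P? : Dec P) (Q? : Dec Q) → P → 𝟙 (P? ×-dec Q?) ≡ 𝟙 Q?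
𝟙-×-yes (yes _) (yes _) _ = refl
𝟙-×-yes (yes _) (no _)  _ = refl
𝟙-×-yes (no ¬p) _       p = contradiction p ¬p

∑ : List A → (A → ℕ) → ℕ
∑ []       f = 0
∑ (x ∷ xs) f = f x + ∑ xs f

syntax ∑ xs (λ x → t) = ∑[ x ∈ xs ] t

∑-cong : ∀ xs {f g : A → ℕ} → (∀ x → f x ≡ g x) → ∑ xs f ≡ ∑ xs g
∑-cong []       f≗g = refl
∑-cong (x ∷ xs) f≗g = cong₂ _+_ (f≗g x) (∑-cong xs f≗g)

∑-+ : ∀ xs (f g : A → ℕ) → ∑[ x ∈ xs ] (f x + g x) ≡ ∑ xs f + ∑ xs g
∑-+ []       f g = refl
∑-+ (x ∷ xs) f g rewrite ∑-+ xs f g = interchange (f x) (g x) (∑ xs f) (∑ xs g)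
  where
  interchange : ∀ a b c d → a + b + (c + d) ≡ a + c + (b + d)
  interchange = solve-∀

∑-++ : ∀ xs ys (f : A → ℕ) → ∑ (xs ++ ys) f ≡ ∑ xs f + ∑ ys f
∑-++ []       ys f = refl
∑-++ (x ∷ xs) ys f = trans (cong (f x +_) (∑-++ xs ys f)) (sym (+-assoc (f x) _ _))

∑-map : ∀ xs (h : A → B) (f : B → ℕ) → ∑ (map h xs) f ≡ ∑[ x ∈ xs ] f (h x)
∑-map []       h f = refl
∑-map (x ∷ xs) h f = cong (f (h x) +_) (∑-map xs h f)

∑-concatMap : ∀ xs (h : A → List B) (f : B → ℕ) → ∑ (concatMap h xs) f ≡ ∑[ x ∈ xs ] ∑ (h x) f
∑-concatMap []       h f = refl
∑-concatMap (x ∷ xs) h f = trans (∑-++ (h x) (concatMap h xs) f) (cong (∑ (h x) f +_) (∑-concatMap xs h f))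

∑-const : ∀ (xs : List A) (c : ℕ) → ∑[ x ∈ xs ] c ≡ length xs * c
∑-const []       c = refl
∑-const (x ∷ xs) c = cong (c +_) (∑-const xs c)

∑>0⇒ : ∀ xs (f : A → ℕ) → 0 < ∑ xs f → ∃ λ x → 0 < f x
∑>0⇒ (x ∷ xs) f ∑>0 with f x in fx≡
... | suc _ = x , subst (0 <_) (sym fx≡) z<s
... | zero  = ∑>0⇒ xs f ∑>0

∑< : ℕ → (ℕ → ℕ) → ℕ
∑< zero    f = 0
∑< (suc k) f = ∑< k f + f k

syntax ∑< k (λ i → t) = ∑[ i < k ] t

∑<-cong : ∀ k {f g : ℕ → ℕ} → (∀ {i} → i < k → f i ≡ g i) → ∑< k f ≡ ∑< k g
∑<-cong zero    f≗g = refl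
∑<-cong (suc k) f≗g = cong₂ _+_ (∑<-cong k (f≗g ∘ m<n⇒m<1+n)) (f≗g ≤-refl)

∑<-const : ∀ k c → ∑[ i < k ] c ≡ k * c
∑<-const zero    c = refl
∑<-const (suc k) c = trans (cong (_+ c) (∑<-const k c)) (+-comm (k * c) c)

∑<-suc : ∀ k f → ∑< (suc k) f ≡ f 0 + ∑[ i < k ] f (suc i)
∑<-suc zero    f = +-comm 0 (f 0)
∑<-suc (suc k) f = trans (cong (_+ f (suc k)) (∑<-suc k f)) (+-assoc (f 0) _ _)

∑<>0⇒ : ∀ k f → 0 < ∑< k f → ∃ λ i → i < k × 0 < f i
∑<>0⇒ (suc k) f ∑>0 with f k in fk≡
... | suc _ = k , ≤-refl , subst (0 <_) (sym fk≡) z<s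
... | zero with ∑<>0⇒ k f (subst (0 <_) (+-identityʳ _) ∑>0)
...   | i , i<k , fi>0 = i , m<n⇒m<1+n i<k , fi>0

∑<≤1 : ∀ k f → (∀ i → f i ≤ 1) → (∀ {i j} → i < k → j < k → 0 < f i → 0 < f j → i ≡ j) → ∑< k f ≤ 1
∑<≤1 zero    f f≤1 unique = z≤n
∑<≤1 (suc k) f f≤1 unique with f k in fk≡
... | zero  = subst (_≤ 1) (sym (+-identityʳ _))
                (∑<≤1 k f f≤1 λ i<k j<k → unique (m<n⇒m<1+n i<k) (m<n⇒m<1+n j<k))
... | suc _ = subst (λ t → t + _ ≤ 1) (sym ∑<k≡0) (subst (_≤ 1) fk≡ (f≤1 k))
  where
  fk>0 : 0 < f k
  fk>0 = subst (0 <_) (sym fk≡) z<s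
  vanish : ∀ {i} → i < k → f i ≡ 0
  vanish {i} i<k = n≤0⇒n≡0 (≮⇒≥ λ fi>0 → <-irrefl (unique (m<n⇒m<1+n i<k) ≤-refl fi>0 fk>0) i<k)
  ∑<k≡0 : ∑< k f ≡ 0
  ∑<k≡0 = trans (∑<-cong k vanish) (trans (∑<-const k 0) (*-zeroʳ k))

∑-∑<-comm : ∀ (xs : List A) k (f : ℕ → A → ℕ) → ∑[ x ∈ xs ] ∑[ i < k ] f i x ≡ ∑[ i < k ] ∑ xs (f i)
∑-∑<-comm xs zero    f = trans (∑-const xs 0) (*-zeroʳ (length xs))
∑-∑<-comm xs (suc k) f = trans (∑-+ xs _ (f k)) (cong (_+ ∑ xs (f k)) (∑-∑<-comm xs k f))

∑<-rotate : ∀ k {g h : ℕ → ℕ} → g 0 ≡ h k → (∀ i → g (suc i) ≡ h i) → ∑< (suc k) g ≡ ∑< (suc k) h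
∑<-rotate k {g} {h} g0≡hk g∘suc≗h = begin
  ∑< (suc k) g                ≡⟨ ∑<-suc k g ⟩
  g 0 + ∑[ i < k ] g (suc i)  ≡⟨ cong₂ _+_ g0≡hk (∑<-cong k λ {i} _ → g∘suc≗h i) ⟩
  h k + ∑< k h                ≡⟨ +-comm (h k) _ ⟩
  ∑< (suc k) h                ∎
  where open ≡-Reasoning

∑-≡0 : ∀ (xs : List A) {f : A → ℕ} → (∀ x → f x ≡ 0) → ∑ xs f ≡ 0
∑-≡0 xs f≗0 = trans (∑-cong xs f≗0) (trans (∑-const xs 0) (*-zeroʳ (length xs)))

∑-allFin : ∀ {m} (f : Fin (suc m) → ℕ) → ∑ (allFin (suc m)) f ≡ f zero + ∑[ i ∈ allFin m ] f (suc i)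
∑-allFin {m} f = cong (f zero +_)
  (trans (cong (λ is → ∑ is f) (sym (List.map-tabulate (λ i → i) suc))) (∑-map (allFin m) suc f))

∑-allFin-𝟙 : ∀ {m} (h : Fin m) → ∑[ g ∈ allFin m ] 𝟙 (h Fin.≟ g) ≡ 1
∑-allFin-𝟙 {suc m} zero    = trans (∑-allFin {m} (λ g → 𝟙 (zero Fin.≟ g)))
  (cong suc (∑-≡0 (allFin m) λ g → 𝟙-no (zero Fin.≟ suc g) λ ()))
∑-allFin-𝟙 {suc m} (suc h) = trans (∑-allFin {m} (λ g → 𝟙 (suc h Fin.≟ g)))
  (trans (∑-cong (allFin m) λ g → 𝟙-cong (suc h Fin.≟ suc g) (h Fin.≟ g) Fin.suc-injective (cong suc)) (∑-allFin-𝟙 h))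

-- Free orbits of an injection of prime order

module FreeOrbits {A : Set} (_≟_ : DecidableEquality A) (σ : A → A)
  (σ-injective : ∀ {x y} → σ x ≡ σ y → x ≡ y) {q : ℕ} (q-prime : Prime q) (L : List A) where

  open import Function.Endo.Propositional A using (^-homo) renaming (_^_ to _^ᶠ_)

  record IsFreeOrbitUnion (P : A → Set) : Set where
    field
      closed       : ∀ {y} → P y → P (σ y)
      fixpointFree : ∀ {y} → P y → σ y ≢ y
      periodic     : ∀ {y} → P y → (σ ^ᶠ q) y ≡ y
      listedOnce   : ∀ {y} → P y → ∑[ z ∈ L ] 𝟙 (y ≟ z) ≡ 1

  iterate-+ : ∀ i j x → (σ ^ᶠ (i + j)) x ≡ (σ ^ᶠ i) ((σ ^ᶠ j) x)
  iterate-+ i j x = cong (λ f → f x) (^-homo σ i j)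

  iterate-fixed : ∀ {d x} → (σ ^ᶠ d) x ≡ x → ∀ u → (σ ^ᶠ (u * d)) x ≡ x
  iterate-fixed σᵈx≡x zero    = refl
  iterate-fixed {d} {x} σᵈx≡x (suc u) =
    trans (iterate-+ d (u * d) x) (trans (cong (σ ^ᶠ d) (iterate-fixed σᵈx≡x u)) σᵈx≡x)

  iterate-injective : ∀ i {x y} → (σ ^ᶠ i) x ≡ (σ ^ᶠ i) y → x ≡ y
  iterate-injective zero    eq = eq
  iterate-injective (suc i) eq = iterate-injective i (σ-injective eq)

  iterate-closed : ∀ {P} → IsFreeOrbitUnion P → ∀ i {x} → P x → P ((σ ^ᶠ i) x)
  iterate-closed free zero    Px = Px
  iterate-closed free (suc i) Px = IsFreeOrbitUnion.closed free (iterate-closed free i Px)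

  module RemoveOrbit {P : A → Set} (P? : Decidable P) (free : IsFreeOrbitUnion P) {x} (Px : P x) where
    open IsFreeOrbitUnion free

    multiplicity : A → ℕ
    multiplicity y = ∑[ i < q ] 𝟙 ((σ ^ᶠ i) x ≟ y)

    -- A period 0 < d < q would give σ x = x, as d is invertible modulo the prime q.
    ¬periodic<q : ∀ {d} → 0 < d → d < q → (σ ^ᶠ d) x ≢ x
    ¬periodic<q {d} 0<d d<q σᵈx≡x
      with coprime⇒bézout {{>-nonZero 0<d}} (Coprimality.sym (prime⇒coprime q-prime {{>-nonZero 0<d}} d<q))
    ... | u , w , du≡1+qw = fixpointFree Px (begin
      σ x                              ≡⟨ cong σ (iterate-fixed (periodic Px) w) ⟨
      σ ((σ ^ᶠ (w * q)) x)             ≡⟨ cong (λ k → (σ ^ᶠ suc k) x) (*-comm w q) ⟩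
      (σ ^ᶠ (1 + q * w)) x             ≡⟨ cong (λ k → (σ ^ᶠ k) x) (trans (*-comm u d) du≡1+qw) ⟨
      (σ ^ᶠ (u * d)) x                 ≡⟨ iterate-fixed σᵈx≡x u ⟩
      x                                ∎)
      where open ≡-Reasoning

    orbit-collision : ∀ {i j} → i < j → j < q → (σ ^ᶠ i) x ≢ (σ ^ᶠ j) x
    orbit-collision {i} {j} i<j j<q σⁱx≡σʲx = ¬periodic<q (m<n⇒0<n∸m i<j) (≤-trans (s≤s (m∸n≤m j i)) j<q)
      (iterate-injective i (sym (begin
        (σ ^ᶠ i) x                     ≡⟨ σⁱx≡σʲx ⟩
        (σ ^ᶠ j) x                     ≡⟨ cong (λ k → (σ ^ᶠ k) x) (m+[n∸m]≡n (<⇒≤ i<j)) ⟨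
        (σ ^ᶠ (i + (j ∸ i))) x         ≡⟨ iterate-+ i (j ∸ i) x ⟩
        (σ ^ᶠ i) ((σ ^ᶠ (j ∸ i)) x)    ∎)))
      where open ≡-Reasoning

    orbit-injective : ∀ {i j} → i < q → j < q → (σ ^ᶠ i) x ≡ (σ ^ᶠ j) x → i ≡ j
    orbit-injective {i} {j} i<q j<q eq with <-cmp i j
    ... | tri< i<j _ _ = contradiction eq (orbit-collision i<j j<q)
    ... | tri≈ _ i≡j _ = i≡j
    ... | tri> _ _ j<i = contradiction (sym eq) (orbit-collision j<i i<q)

    multiplicity≤1 : ∀ y → multiplicity y ≤ 1
    multiplicity≤1 y = ∑<≤1 q _ (λ i → 𝟙≤1 ((σ ^ᶠ i) x ≟ y)) λ i<q j<q i-hit j-hit →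
      orbit-injective i<q j<q (trans (𝟙>0⇒ (_ ≟ y) i-hit) (sym (𝟙>0⇒ (_ ≟ y) j-hit)))

    multiplicity>0⇒P : ∀ {y} → 0 < multiplicity y → P y
    multiplicity>0⇒P {y} m>0 with ∑<>0⇒ q _ m>0
    ... | i , _ , hit = subst P (𝟙>0⇒ (_ ≟ y) hit) (iterate-closed free i Px)

    multiplicity-σ : ∀ y → multiplicity (σ y) ≡ multiplicity y
    multiplicity-σ y = subst (λ m → ∑< m _ ≡ ∑< m _) (suc-pred q) (∑<-rotate (pred q)
      (𝟙-cong (x ≟ σ y) (_ ≟ y) (λ x≡σy → σ-injective (trans (sym x≡σσᵏx) x≡σy))
                                (λ σᵏx≡y → trans x≡σσᵏx (cong σ σᵏx≡y)))
      (λ i → 𝟙-cong (_ ≟ σ y) (_ ≟ y) σ-injective (cong σ)))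
      where
      instance _ = prime⇒nonZero q-prime
      x≡σσᵏx : x ≡ σ ((σ ^ᶠ pred q) x)
      x≡σσᵏx = sym (subst (λ m → (σ ^ᶠ m) x ≡ x) (sym (suc-pred q)) (periodic Px))

    ∑-multiplicity : ∑ L multiplicity ≡ q
    ∑-multiplicity = begin
      ∑ L multiplicity                                 ≡⟨ ∑-∑<-comm L q _ ⟩
      ∑[ i < q ] ∑[ y ∈ L ] 𝟙 ((σ ^ᶠ i) x ≟ y)
        ≡⟨ ∑<-cong q (λ {i} _ → listedOnce (iterate-closed free i Px)) ⟩
      ∑[ i < q ] 1                                     ≡⟨ ∑<-const q 1 ⟩
      q * 1                                            ≡⟨ *-identityʳ q ⟩
      q                                                ∎
      where open ≡-Reasoning

    P′ : A → Set
    P′ y = P y × multiplicity y ≡ 0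

    P′? : Decidable P′
    P′? y = P? y ×-dec (multiplicity y ℕ.≟ 0)

    𝟙-P≡𝟙-P′+multiplicity : ∀ y → 𝟙 (P? y) ≡ 𝟙 (P? y ×-dec (multiplicity y ℕ.≟ 0)) + multiplicity y
    𝟙-P≡𝟙-P′+multiplicity y with P? y | multiplicity y | multiplicity≤1 y | multiplicity>0⇒P {y}
    ... | yes _  | 0     | _         | _    = refl
    ... | yes _  | 1     | _         | _    = refl
    ... | yes _  | 2+ _  | s≤s ()    | _
    ... | no _   | 0     | _         | _    = refl
    ... | no ¬Py | suc _ | _         | m⇒P  = contradiction (m⇒P z<s) ¬Py

    P′-free : IsFreeOrbitUnion P′
    P′-free = record
      { closed       = λ { {y} (Py , m≡0) → closed Py , trans (multiplicity-σ y) m≡0 }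
      ; fixpointFree = fixpointFree ∘ proj₁
      ; periodic     = periodic ∘ proj₁
      ; listedOnce   = listedOnce ∘ proj₁
      }

    count-P≡count-P′+q : ∑[ y ∈ L ] 𝟙 (P? y) ≡ ∑[ y ∈ L ] 𝟙 (P′? y) + q
    count-P≡count-P′+q = trans (∑-cong L 𝟙-P≡𝟙-P′+multiplicity)
      (trans (∑-+ L _ multiplicity) (cong (∑[ y ∈ L ] 𝟙 (P′? y) +_) ∑-multiplicity))

  freeOrbitUnion⇒∣count : ∀ {P} (P? : Decidable P) → IsFreeOrbitUnion P → q ∣ ∑[ y ∈ L ] 𝟙 (P? y)
  freeOrbitUnion⇒∣count P? free = <-rec Goal step _ P? free refl
    where
    Goal : ℕ → Set₁
    Goal c = ∀ {P} (P? : Decidable P) → IsFreeOrbitUnion P → ∑[ y ∈ L ] 𝟙 (P? y) ≡ c → q ∣ c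
    step : ∀ c → (∀ {c′} → c′ < c → Goal c′) → Goal c
    step zero    _   _  _    _       = q ∣0
    step (suc c) rec P? free count≡c with ∑>0⇒ L _ (subst (0 <_) (sym count≡c) z<s)
    ... | x , Px>0 = subst (q ∣_) (trans (sym count-P≡count-P′+q) count≡c)
                       (∣m∣n⇒∣m+n (rec count-P′<c P′? P′-free refl) ∣-refl)
      where
      open RemoveOrbit P? free (𝟙>0⇒ (P? x) Px>0)
      count-P′<c : ∑[ y ∈ L ] 𝟙 (P′? y) < suc c
      count-P′<c = subst (∑[ y ∈ L ] 𝟙 (P′? y) <_) (trans (sym count-P≡count-P′+q) count≡c)
                     (m<m+n _ (<-trans z<s (prime>1 q-prime)))

-- Rotation of lists

∷ʳ≢[] : ∀ {A : Set} (w : List A) {x} → w ∷ʳ x ≢ []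
∷ʳ≢[] []      ()
∷ʳ≢[] (_ ∷ _) ()

module _ {A : Set} where
  open import Function.Endo.Propositional (List A) using (^-homo) renaming (_^_ to _^ᶠ_)

  rotate : List A → List A
  rotate []      = []
  rotate (x ∷ w) = w ∷ʳ x

  rotate-injective : ∀ {v w} → rotate v ≡ rotate w → v ≡ w
  rotate-injective {[]}    {[]}    _  = refl
  rotate-injective {[]}    {y ∷ w} eq = contradiction (sym eq) (∷ʳ≢[] w)
  rotate-injective {x ∷ v} {[]}    eq = contradiction eq (∷ʳ≢[] v)
  rotate-injective {x ∷ v} {y ∷ w} eq with List.∷ʳ-injective v w eq
  ... | refl , refl = refl

  length-rotate : ∀ v → length (rotate v) ≡ length v
  length-rotate []      = refl
  length-rotate (x ∷ w) = trans (List.length-++ w) (+-comm (length w) 1)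

  iterate-rotate-++ : ∀ u w → (rotate ^ᶠ length u) (u ++ w) ≡ w ++ u
  iterate-rotate-++ []      w = sym (List.++-identityʳ w)
  iterate-rotate-++ (x ∷ u) w = begin
    (rotate ^ᶠ suc (length u)) (x ∷ u ++ w)       ≡⟨ cong (λ k → (rotate ^ᶠ k) (x ∷ u ++ w)) (+-comm 1 (length u)) ⟩
    (rotate ^ᶠ (length u + 1)) (x ∷ u ++ w)       ≡⟨ cong (λ f → f (x ∷ u ++ w)) (^-homo rotate (length u) 1) ⟩
    (rotate ^ᶠ length u) ((u ++ w) ∷ʳ x)          ≡⟨ cong (rotate ^ᶠ length u) (List.++-assoc u w (x ∷ [])) ⟩
    (rotate ^ᶠ length u) (u ++ w ∷ʳ x)            ≡⟨ iterate-rotate-++ u (w ∷ʳ x) ⟩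
    (w ∷ʳ x) ++ u                                 ≡⟨ List.++-assoc w (x ∷ []) u ⟩
    w ++ x ∷ u                                    ∎
    where open ≡-Reasoning

  rotate-periodic : ∀ v → (rotate ^ᶠ length v) v ≡ v
  rotate-periodic v = trans (cong (rotate ^ᶠ length v) (sym (List.++-identityʳ v))) (iterate-rotate-++ v [])

  rotate-replicate : ∀ k (x : A) → rotate (replicate k x) ≡ replicate k x
  rotate-replicate zero    x = refl
  rotate-replicate (suc k) x = replicate-∷ʳ k
    where
    replicate-∷ʳ : ∀ k → replicate k x ∷ʳ x ≡ x ∷ replicate k x
    replicate-∷ʳ zero    = refl
    replicate-∷ʳ (suc k) = cong (x ∷_) (replicate-∷ʳ k)

  rotate-fixed⇒replicate : ∀ x w → rotate (x ∷ w) ≡ x ∷ w → x ∷ w ≡ replicate (suc (length w)) x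
  rotate-fixed⇒replicate x []      _  = refl
  rotate-fixed⇒replicate x (y ∷ w) eq with List.∷-injective eq
  ... | refl , w∷ʳx≡x∷w = cong (x ∷_) (rotate-fixed⇒replicate x w w∷ʳx≡x∷w)

-- Line graphs are claw-free

record Claw (Γ : Graph) : Set where
  field
    centre             : V Γ
    leaf               : Fin 3 → V Γ
    centre-adjacent    : ∀ i → Adj Γ centre (leaf i)
    leaves-nonadjacent : ∀ {i j} → i ≢ j → ¬ Adj Γ (leaf i) (leaf j)
    leaves-distinct    : ∀ {i j} → i ≢ j → ¬ _≈_ Γ (leaf i) (leaf j)

module _ {m : ℕ} where

  Touches : Fin m → Fin m × Fin m → Set
  Touches t (a , b) = t ≡ a ⊎ t ≡ b

  shareEndpoint⇒touches : ∀ {u v} l → ShareEndpoint (u , v) l → Touches u l ⊎ Touches v l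
  shareEndpoint⇒touches _ (inj₁ u≡a)               = inj₁ (inj₁ u≡a)
  shareEndpoint⇒touches _ (inj₂ (inj₁ u≡b))        = inj₁ (inj₂ u≡b)
  shareEndpoint⇒touches _ (inj₂ (inj₂ (inj₁ v≡a))) = inj₂ (inj₁ v≡a)
  shareEndpoint⇒touches _ (inj₂ (inj₂ (inj₂ v≡b))) = inj₂ (inj₂ v≡b)

  touches⇒shareEndpoint : ∀ {t} l l′ → Touches t l → Touches t l′ → ShareEndpoint l l′
  touches⇒shareEndpoint _ _ (inj₁ refl) (inj₁ refl) = inj₁ refl
  touches⇒shareEndpoint _ _ (inj₁ refl) (inj₂ refl) = inj₂ (inj₁ refl)
  touches⇒shareEndpoint _ _ (inj₂ refl) (inj₁ refl) = inj₂ (inj₂ (inj₁ refl))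
  touches⇒shareEndpoint _ _ (inj₂ refl) (inj₂ refl) = inj₂ (inj₂ (inj₂ refl))

-- The centre edge has two endpoints, so two of the three leaf edges meet it at the same endpoint.
≅lineGraph⇒clawFree : ∀ {Γ m} {Λ : SimpleGraph m} → IsEquivalence (_≈_ Γ) → Γ ≅ LineGraph Λ → ¬ Claw Γ
≅lineGraph⇒clawFree {Γ} {m} ≈-isEquivalence iso claw =
  sameSide⇒adjacent (Fin.pigeonhole (s<s (s<s z<s)) (side ∘ touch))
  where
  open Claw claw
  open _≅_ iso
  open IsEquivalence ≈-isEquivalence renaming (sym to ≈-sym; trans to ≈-trans)

  edge : V Γ → Fin m × Fin m
  edge x = proj₁ (to x)

  u v : Fin m
  u = proj₁ (edge centre)
  v = proj₂ (edge centre)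

  touch : ∀ i → Touches u (edge (leaf i)) ⊎ Touches v (edge (leaf i))
  touch i = shareEndpoint⇒touches _ (proj₂ (Equivalence.to (adj centre (leaf i)) (centre-adjacent i)))

  side : ∀ {l} → Touches u l ⊎ Touches v l → Fin 2
  side (inj₁ _) = zero
  side (inj₂ _) = suc zero

  sameSide⇒share : ∀ {l l′} (t : Touches u l ⊎ Touches v l) (t′ : Touches u l′ ⊎ Touches v l′) →
                   side t ≡ side t′ → ShareEndpoint l l′
  sameSide⇒share (inj₁ t) (inj₁ t′) _ = touches⇒shareEndpoint _ _ t t′
  sameSide⇒share (inj₂ t) (inj₂ t′) _ = touches⇒shareEndpoint _ _ t t′

  edge-injective : ∀ {x y} → edge x ≡ edge y → _≈_ Γ x y
  edge-injective {x} {y} eq = ≈-trans (≈-sym (from∘to x)) (≈-trans (from-cong (to x) (to y) eq) (from∘to y))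

  sameSide⇒adjacent : (∃₂ λ i j → i <ᶠ j × side (touch i) ≡ side (touch j)) → ⊥
  sameSide⇒adjacent (i , j , i<j , same) = leaves-nonadjacent (Fin.<⇒≢ i<j)
    (Equivalence.from (adj (leaf i) (leaf j))
      (leaves-distinct (Fin.<⇒≢ i<j) ∘ edge-injective , sameSide⇒share (touch i) (touch j) same))

-- Finite groups

module GroupTheory (G : FinGroup) where
  open FinGroup G hiding (n)

  Element : Set
  Element = Fin (n G)

  group : Group 0ℓ 0ℓ
  group = record
    { Carrier = Element ; _≈_ = _≡_ ; _∙_ = _·_ ; ε = e ; _⁻¹ = inv
    ; isGroup = record
      { isMonoid = record
        { isSemigroup = record
          { isMagma = record { isEquivalence = isEquivalence ; ∙-cong = cong₂ _·_ }
          ; assoc = assoc }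
        ; identity = idˡ , idʳ }
      ; inverse = invˡ , invʳ
      ; ⁻¹-cong = cong inv } }

  open GroupProperties group using (∙-cancelˡ; ∙-cancelʳ; ⁻¹-involutive; ⁻¹-anti-homo-∙; inverseʳ-unique; ε⁻¹≈ε)

  Commute : Element → Element → Set
  Commute a b = a · b ≡ b · a

  commute-eʳ : ∀ a → Commute a e
  commute-eʳ a = trans (idʳ a) (sym (idˡ a))

  commute-·ʳ : ∀ {a b c} → Commute a b → Commute a c → Commute a (b · c)
  commute-·ʳ {a} {b} {c} ab≡ba ac≡ca = begin
    a · (b · c)  ≡⟨ assoc a b c ⟨
    (a · b) · c  ≡⟨ cong (_· c) ab≡ba ⟩
    (b · a) · c  ≡⟨ assoc b a c ⟩
    b · (a · c)  ≡⟨ cong (b ·_) ac≡ca ⟩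
    b · (c · a)  ≡⟨ assoc b c a ⟨
    (b · c) · a  ∎
    where open ≡-Reasoning

  commute-·ˡ : ∀ {a b c} → Commute a c → Commute b c → Commute (a · b) c
  commute-·ˡ ac≡ca bc≡cb = sym (commute-·ʳ (sym ac≡ca) (sym bc≡cb))

  commute-powʳ : ∀ {a b} → Commute a b → ∀ k → Commute a (pow b k)
  commute-powʳ {a} ab≡ba zero    = commute-eʳ a
  commute-powʳ     ab≡ba (suc k) = commute-·ʳ ab≡ba (commute-powʳ ab≡ba k)

  pow-commute : ∀ x i j → Commute (pow x i) (pow x j)
  pow-commute x i j = commute-powʳ (sym (commute-powʳ refl i)) j

  pow-+ : ∀ x i j → pow x (i + j) ≡ pow x i · pow x j
  pow-+ x zero    j = sym (idˡ (pow x j))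
  pow-+ x (suc i) j = trans (cong (x ·_) (pow-+ x i j)) (sym (assoc x _ _))

  pow-* : ∀ x i j → pow x (i * j) ≡ pow (pow x i) j
  pow-* x i zero    = cong (pow x) (*-zeroʳ i)
  pow-* x i (suc j) =
    trans (cong (pow x) (*-suc i j)) (trans (pow-+ x i (i * j)) (cong (pow x i ·_) (pow-* x i j)))

  pow-e : ∀ k → pow e k ≡ e
  pow-e zero    = refl
  pow-e (suc k) = trans (idˡ (pow e k)) (pow-e k)

  pow-*-≡e : ∀ {x m} → pow x m ≡ e → ∀ k → pow x (m * k) ≡ e
  pow-*-≡e {x} {m} xᵐ≡e k = trans (pow-* x m k) (trans (cong (λ y → pow y k) xᵐ≡e) (pow-e k))

  pow-·-commute : ∀ {x y} → Commute x y → ∀ k → pow (x · y) k ≡ pow x k · pow y k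
  pow-·-commute {x} {y} xy≡yx zero    = sym (idˡ e)
  pow-·-commute {x} {y} xy≡yx (suc k) = begin
    (x · y) · pow (x · y) k          ≡⟨ cong ((x · y) ·_) (pow-·-commute xy≡yx k) ⟩
    (x · y) · (pow x k · pow y k)    ≡⟨ assoc x y _ ⟩
    x · (y · (pow x k · pow y k))    ≡⟨ cong (x ·_) (assoc y (pow x k) (pow y k)) ⟨
    x · ((y · pow x k) · pow y k)    ≡⟨ cong (λ z → x · (z · pow y k)) (commute-powʳ (sym xy≡yx) k) ⟩
    x · ((pow x k · y) · pow y k)    ≡⟨ cong (x ·_) (assoc (pow x k) y (pow y k)) ⟩
    x · (pow x k · (y · pow y k))    ≡⟨ assoc x (pow x k) _ ⟨
    (x · pow x k) · (y · pow y k)    ∎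
    where open ≡-Reasoning

  pow-inv : ∀ x k → pow (inv x) k ≡ inv (pow x k)
  pow-inv x k = inverseʳ-unique (pow x k) (pow (inv x) k) (begin
    pow x k · pow (inv x) k    ≡⟨ pow-·-commute (trans (invʳ x) (sym (invˡ x))) k ⟨
    pow (x · inv x) k          ≡⟨ cong (λ y → pow y k) (invʳ x) ⟩
    pow e k                    ≡⟨ pow-e k ⟩
    e                          ∎)
    where open ≡-Reasoning

  finite-order : ∀ x → ∃[ m ] pow x (suc m) ≡ e
  finite-order x with Fin.pigeonhole (n<1+n (n G)) (λ (i : Fin (suc (n G))) → pow x (toℕ i))
  ... | i , j , i<j , xⁱ≡xʲ with m≤n⇒∃[o]m+o≡n i<j
  ...   | k , 1+i+k≡j = k , ∙-cancelʳ (pow x (toℕ i)) _ _ (begin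
    pow x (suc k) · pow x (toℕ i)   ≡⟨ pow-+ x (suc k) (toℕ i) ⟨
    pow x (suc k + toℕ i)           ≡⟨ cong (pow x) (trans (cong suc (+-comm k (toℕ i))) 1+i+k≡j) ⟩
    pow x (toℕ j)                   ≡⟨ xⁱ≡xʲ ⟨
    pow x (toℕ i)                   ≡⟨ idˡ _ ⟨
    e · pow x (toℕ i)               ∎)
    where open ≡-Reasoning

  module FreeGroupSolver where
    infixl 7 _⊗_
    infix  8 _⁻

    data Term (k : ℕ) : Set where
      var  : Fin k → Term k
      unit : Term k
      _⊗_  : Term k → Term k → Term k
      _⁻   : Term k → Term k

    ⟦_⟧ : ∀ {k} → Term k → Vec Element k → Element
    ⟦ var i ⟧ ρ = lookup ρ i
    ⟦ unit  ⟧ ρ = e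
    ⟦ s ⊗ t ⟧ ρ = ⟦ s ⟧ ρ · ⟦ t ⟧ ρ
    ⟦ s ⁻   ⟧ ρ = inv (⟦ s ⟧ ρ)

    ⁅_,_⁆ : ∀ {k} → Term k → Term k → Term k
    ⁅ s , t ⁆ = s ⊗ t ⊗ s ⁻ ⊗ t ⁻

    x₀ : ∀ {k} → Term (suc k)
    x₀ = var zero
    x₁ : ∀ {k} → Term (suc (suc k))
    x₁ = var (suc zero)
    x₂ : ∀ {k} → Term (suc (suc (suc k)))
    x₂ = var (suc (suc zero))
    x₃ : ∀ {k} → Term (suc (suc (suc (suc k))))
    x₃ = var (suc (suc (suc zero)))

    -- A letter (i , false) stands for the inverse of the i-th variable.
    Letter : ℕ → Set
    Letter k = Fin k × Bool

    Word : ℕ → Set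
    Word k = List (Letter k)

    ⟦_⟧ˡ : ∀ {k} → Letter k → Vec Element k → Element
    ⟦ i , true  ⟧ˡ ρ = lookup ρ i
    ⟦ i , false ⟧ˡ ρ = inv (lookup ρ i)

    ⟦_⟧ʷ : ∀ {k} → Word k → Vec Element k → Element
    ⟦ []    ⟧ʷ ρ = e
    ⟦ l ∷ w ⟧ʷ ρ = ⟦ l ⟧ˡ ρ · ⟦ w ⟧ʷ ρ

    invertLetter : ∀ {k} → Letter k → Letter k
    invertLetter (i , b) = i , not b

    invertWord : ∀ {k} → Word k → Word k
    invertWord []      = []
    invertWord (l ∷ w) = invertWord w ++ invertLetter l ∷ []

    word : ∀ {k} → Term k → Word k
    word (var i) = (i , true) ∷ []
    word unit    = []
    word (s ⊗ t) = word s ++ word t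
    word (s ⁻)   = invertWord (word s)

    consReduced : ∀ {k} → Letter k → Word k → Word k
    consReduced l [] = l ∷ []
    consReduced (i , b) ((j , c) ∷ w) with i Fin.≟ j | b Bool.≟ not c
    ... | yes _ | yes _ = w
    ... | _     | _     = (i , b) ∷ (j , c) ∷ w

    reduce : ∀ {k} → Word k → Word k
    reduce []      = []
    reduce (l ∷ w) = consReduced l (reduce w)

    ⟦++⟧ : ∀ {k} (u w : Word k) ρ → ⟦ u ++ w ⟧ʷ ρ ≡ ⟦ u ⟧ʷ ρ · ⟦ w ⟧ʷ ρ
    ⟦++⟧ []      w ρ = sym (idˡ _)
    ⟦++⟧ (l ∷ u) w ρ = trans (cong (⟦ l ⟧ˡ ρ ·_) (⟦++⟧ u w ρ)) (sym (assoc _ _ _))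

    ⟦invertLetter⟧ : ∀ {k} (l : Letter k) ρ → ⟦ invertLetter l ⟧ˡ ρ ≡ inv (⟦ l ⟧ˡ ρ)
    ⟦invertLetter⟧ (i , true)  ρ = refl
    ⟦invertLetter⟧ (i , false) ρ = sym (⁻¹-involutive _)

    ⟦invertWord⟧ : ∀ {k} (w : Word k) ρ → ⟦ invertWord w ⟧ʷ ρ ≡ inv (⟦ w ⟧ʷ ρ)
    ⟦invertWord⟧ []      ρ = sym ε⁻¹≈ε
    ⟦invertWord⟧ (l ∷ w) ρ = begin
      ⟦ invertWord w ++ invertLetter l ∷ [] ⟧ʷ ρ   ≡⟨ ⟦++⟧ (invertWord w) _ ρ ⟩
      ⟦ invertWord w ⟧ʷ ρ · (⟦ invertLetter l ⟧ˡ ρ · e)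
        ≡⟨ cong₂ _·_ (⟦invertWord⟧ w ρ) (trans (idʳ _) (⟦invertLetter⟧ l ρ)) ⟩
      inv (⟦ w ⟧ʷ ρ) · inv (⟦ l ⟧ˡ ρ)              ≡⟨ ⁻¹-anti-homo-∙ _ _ ⟨
      inv (⟦ l ⟧ˡ ρ · ⟦ w ⟧ʷ ρ)                    ∎
      where open ≡-Reasoning

    ⟦word⟧ : ∀ {k} (t : Term k) ρ → ⟦ word t ⟧ʷ ρ ≡ ⟦ t ⟧ ρ
    ⟦word⟧ (var i) ρ = idʳ _
    ⟦word⟧ unit    ρ = refl
    ⟦word⟧ (s ⊗ t) ρ = trans (⟦++⟧ (word s) (word t) ρ) (cong₂ _·_ (⟦word⟧ s ρ) (⟦word⟧ t ρ))
    ⟦word⟧ (s ⁻)   ρ = trans (⟦invertWord⟧ (word s) ρ) (cong inv (⟦word⟧ s ρ))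

    ⟦consReduced⟧ : ∀ {k} (l : Letter k) w ρ → ⟦ consReduced l w ⟧ʷ ρ ≡ ⟦ l ⟧ˡ ρ · ⟦ w ⟧ʷ ρ
    ⟦consReduced⟧ l [] ρ = refl
    ⟦consReduced⟧ (i , b) ((j , c) ∷ w) ρ with i Fin.≟ j | b Bool.≟ not c
    ... | yes refl | yes refl = sym (trans (sym (assoc _ _ _)) (trans (cong (_· ⟦ w ⟧ʷ ρ) (cancel c)) (idˡ _)))
      where
      cancel : ∀ c → ⟦ i , not c ⟧ˡ ρ · ⟦ i , c ⟧ˡ ρ ≡ e
      cancel true  = invˡ _
      cancel false = invʳ _
    ... | yes _ | no _  = refl
    ... | no _  | yes _ = refl
    ... | no _  | no _  = refl

    ⟦reduce⟧ : ∀ {k} (w : Word k) ρ → ⟦ reduce w ⟧ʷ ρ ≡ ⟦ w ⟧ʷ ρ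
    ⟦reduce⟧ []      ρ = refl
    ⟦reduce⟧ (l ∷ w) ρ = trans (⟦consReduced⟧ l (reduce w) ρ) (cong (⟦ l ⟧ˡ ρ ·_) (⟦reduce⟧ w ρ))

    -- The premise is decided by evaluation, so closed instances are proved by refl.
    solve : ∀ {k} (s t : Term k) → reduce (word s) ≡ reduce (word t) → ∀ ρ → ⟦ s ⟧ ρ ≡ ⟦ t ⟧ ρ
    solve s t same ρ = begin
      ⟦ s ⟧ ρ                     ≡⟨ ⟦word⟧ s ρ ⟨
      ⟦ word s ⟧ʷ ρ               ≡⟨ ⟦reduce⟧ (word s) ρ ⟨
      ⟦ reduce (word s) ⟧ʷ ρ      ≡⟨ cong (λ w → ⟦ w ⟧ʷ ρ) same ⟩
      ⟦ reduce (word t) ⟧ʷ ρ      ≡⟨ ⟦reduce⟧ (word t) ρ ⟩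
      ⟦ word t ⟧ʷ ρ               ≡⟨ ⟦word⟧ t ρ ⟩
      ⟦ t ⟧ ρ                     ∎
      where open ≡-Reasoning

  open FreeGroupSolver using (solve; _⊗_; _⁻; unit; ⁅_,_⁆; x₀; x₁; x₂; x₃)

  comm≡e⇒commute : ∀ {a b} → comm a b ≡ e → Commute a b
  comm≡e⇒commute {a} {b} [a,b]≡e = begin
    a · b                    ≡⟨ solve (x₀ ⊗ x₁) (⁅ x₀ , x₁ ⁆ ⊗ x₁ ⊗ x₀) refl (a ∷ b ∷ []) ⟩
    (comm a b · b) · a       ≡⟨ cong (λ c → (c · b) · a) [a,b]≡e ⟩
    (e · b) · a              ≡⟨ cong (_· a) (idˡ b) ⟩
    b · a                    ∎
    where open ≡-Reasoning

  record IsNormalSubgroup (H : Element → Set) : Set where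
    field
      e∈H              : H e
      ·-closed         : ∀ {a b} → H a → H b → H (a · b)
      inv-closed       : ∀ {a} → H a → H (inv a)
      conjugate-closed : ∀ c {a} → H a → H ((c · a) · inv c)

    pow-closed : ∀ {a} → H a → ∀ k → H (pow a k)
    pow-closed a∈H zero    = e∈H
    pow-closed a∈H (suc k) = ·-closed a∈H (pow-closed a∈H k)

    coprimePowers⇒∈ : ∀ {c A B} .{{_ : NonZero A}} → Coprime A B → H (pow c A) → H (pow c B) → H c
    coprimePowers⇒∈ {c} {A} {B} A⊥B cᴬ∈H cᴮ∈H with coprime⇒bézout A⊥B
    ... | u , w , Au≡1+Bw = subst H c≡ (·-closed (subst H (sym (pow-* c A u)) (pow-closed cᴬ∈H u))
                                                   (inv-closed (subst H (sym (pow-* c B w)) (pow-closed cᴮ∈H w))))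
      where
      c≡ : pow c (A * u) · inv (pow c (B * w)) ≡ c
      c≡ = begin
        pow c (A * u) · inv (pow c (B * w))          ≡⟨ cong (λ k → pow c k · inv (pow c (B * w))) Au≡1+Bw ⟩
        (c · pow c (B * w)) · inv (pow c (B * w))    ≡⟨ solve (x₀ ⊗ x₁ ⊗ x₁ ⁻) x₀ refl (c ∷ pow c (B * w) ∷ []) ⟩
        c                                            ∎
        where open ≡-Reasoning

  Z-normal : ∀ i → IsNormalSubgroup (Z i)
  Z-normal zero = record
    { e∈H              = refl
    ; ·-closed         = λ { refl refl → idˡ e }
    ; inv-closed       = λ { refl → ε⁻¹≈ε }
    ; conjugate-closed = λ { c refl → trans (cong (_· inv c) (idʳ c)) (invʳ c) }
    }
  Z-normal (suc i) = record
    { e∈H              = λ x → subst (Z i) (solve unit ⁅ unit , x₀ ⁆ refl (x ∷ [])) e∈H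
    ; ·-closed         = λ {a} {b} a∈ b∈ x → subst (Z i)
        (solve (x₀ ⊗ ⁅ x₁ , x₂ ⁆ ⊗ x₀ ⁻ ⊗ ⁅ x₀ , x₂ ⁆) ⁅ x₀ ⊗ x₁ , x₂ ⁆ refl (a ∷ b ∷ x ∷ []))
        (·-closed (conjugate-closed a (b∈ x)) (a∈ x))
    ; inv-closed       = λ {a} a∈ x → subst (Z i)
        (solve (x₀ ⁻ ⊗ ⁅ x₀ , x₁ ⁆ ⁻ ⊗ x₀ ⁻ ⁻) ⁅ x₀ ⁻ , x₁ ⁆ refl (a ∷ x ∷ []))
        (conjugate-closed (inv a) (inv-closed (a∈ x)))
    ; conjugate-closed = λ c {a} a∈ x → subst (Z i)
        (solve (x₁ ⊗ ⁅ x₀ , x₁ ⁻ ⊗ x₂ ⊗ x₁ ⁆ ⊗ x₁ ⁻) ⁅ x₁ ⊗ x₀ ⊗ x₁ ⁻ , x₂ ⁆ refl (a ∷ c ∷ x ∷ []))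
        (conjugate-closed c (a∈ ((inv c · x) · c)))
    }
    where open IsNormalSubgroup (Z-normal i)

  -- As [a,b] is central modulo Z i, conjugating b by aᵏ multiplies it by [a,b]ᵏ modulo Z i; take k = K.
  commutator-pow : ∀ i {a b K} → Z (suc i) (comm a b) → pow a K ≡ e → Z i (pow (comm a b) K)
  commutator-pow i {a} {b} {K} [a,b]∈ aᴷ≡e =
    subst (Z i) (⁻¹-involutive _) (inv-closed (subst (Z i) at-K (conjugation-by-pow K)))
    where
    open IsNormalSubgroup (Z-normal i)
    c = comm a b
    conjugation-by-pow : ∀ k → Z i (((pow a k · b) · inv (pow a k)) · inv (pow c k · b))
    conjugation-by-pow zero    =
      subst (Z i) (sym (solve (unit ⊗ x₀ ⊗ unit ⁻ ⊗ (unit ⊗ x₀) ⁻) unit refl (b ∷ []))) e∈H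
    conjugation-by-pow (suc k) = subst (Z i)
      (solve (x₀ ⊗ (x₂ ⊗ x₁ ⊗ x₂ ⁻ ⊗ (x₃ ⊗ x₁) ⁻) ⊗ x₀ ⁻ ⊗ (⁅ x₃ , x₀ ⁆ ⁻ ⊗ ⁅ x₃ , ⁅ x₀ , x₁ ⁆ ⁆))
             (x₀ ⊗ x₂ ⊗ x₁ ⊗ (x₀ ⊗ x₂) ⁻ ⊗ (⁅ x₀ , x₁ ⁆ ⊗ x₃ ⊗ x₁) ⁻) refl (a ∷ b ∷ pow a k ∷ pow c k ∷ []))
      (·-closed (conjugate-closed a (conjugation-by-pow k)) (·-closed (inv-closed (cᵏ∈ a)) (cᵏ∈ c)))
      where cᵏ∈ = IsNormalSubgroup.pow-closed (Z-normal (suc i)) [a,b]∈ k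
    at-K : ((pow a K · b) · inv (pow a K)) · inv (pow c K · b) ≡ inv (pow c K)
    at-K = trans (cong (λ d → ((d · b) · inv d) · inv (pow c K · b)) aᴷ≡e)
                (solve (unit ⊗ x₀ ⊗ unit ⁻ ⊗ (x₁ ⊗ x₀) ⁻) (x₁ ⁻) refl (b ∷ pow c K ∷ []))

  commutator-descends : ∀ i {a b A B} .{{_ : NonZero A}} → Coprime A B → pow a A ≡ e → pow b B ≡ e →
                        Z (suc i) (comm a b) → Z i (comm a b)
  commutator-descends i {a} {b} {A} {B} A⊥B aᴬ≡e bᴮ≡e [a,b]∈ =
    coprimePowers⇒∈ A⊥B (commutator-pow i {K = A} [a,b]∈ aᴬ≡e)
      (subst (Z i) (⁻¹-involutive _)
        (inv-closed (subst (Z i) [b,a]ᴮ≡[a,b]ᴮ⁻¹ (commutator-pow i {K = B} [b,a]∈ bᴮ≡e))))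
    where
    open IsNormalSubgroup (Z-normal i)
    [b,a]≡[a,b]⁻¹ : comm b a ≡ inv (comm a b)
    [b,a]≡[a,b]⁻¹ = solve ⁅ x₁ , x₀ ⁆ (⁅ x₀ , x₁ ⁆ ⁻) refl (a ∷ b ∷ [])
    [b,a]∈ : Z (suc i) (comm b a)
    [b,a]∈ = subst (Z (suc i)) (sym [b,a]≡[a,b]⁻¹) (IsNormalSubgroup.inv-closed (Z-normal (suc i)) [a,b]∈)
    [b,a]ᴮ≡[a,b]ᴮ⁻¹ : pow (comm b a) B ≡ inv (pow (comm a b) B)
    [b,a]ᴮ≡[a,b]ᴮ⁻¹ = trans (cong (λ d → pow d B) [b,a]≡[a,b]⁻¹) (pow-inv (comm a b) B)

  coprime-exponents⇒commute : IsNilpotent G → ∀ {a b A B} .{{_ : NonZero A}} → Coprime A B →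
                              pow a A ≡ e → pow b B ≡ e → Commute a b
  coprime-exponents⇒commute (k , Zₖ≡G) {a} {b} A⊥B aᴬ≡e bᴮ≡e = comm≡e⇒commute (descend k (Zₖ≡G (comm a b)))
    where
    descend : ∀ i → Z i (comm a b) → Z 0 (comm a b)
    descend zero    [a,b]∈ = [a,b]∈
    descend (suc i) [a,b]∈ = descend i (commutator-descends i A⊥B aᴬ≡e bᴮ≡e [a,b]∈)

  coprime-exponents⇒≡e : ∀ {x A B} .{{_ : NonZero A}} → Coprime A B → pow x A ≡ e → pow x B ≡ e → x ≡ e
  coprime-exponents⇒≡e = IsNormalSubgroup.coprimePowers⇒∈ (Z-normal 0)

  coprimeSplit : ∀ x {A B} .{{_ : NonZero B}} → Coprime A B → pow x (A * B) ≡ e →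
                 ∃₂ λ y z → x ≡ y · z × pow y A ≡ e × pow z B ≡ e
  coprimeSplit x {A} {B} A⊥B xᴬᴮ≡e with coprime⇒bézout (Coprimality.sym A⊥B)
  ... | u , w , Bu≡1+Aw = pow x (B * u) , inv (pow x (A * w)) , x≡ ,
    trans (sym (pow-* x (B * u) A)) (trans (cong (pow x) (yᴬ-exponent A B u)) (pow-*-≡e {x} {A * B} xᴬᴮ≡e u)) ,
    trans (pow-inv (pow x (A * w)) B) (trans (cong inv (trans (sym (pow-* x (A * w) B))
      (trans (cong (pow x) (zᴮ-exponent A B w)) (pow-*-≡e {x} {A * B} xᴬᴮ≡e w)))) ε⁻¹≈ε)
    where
    x≡ : x ≡ pow x (B * u) · inv (pow x (A * w))
    x≡ = sym (trans (cong (λ k → pow x k · inv (pow x (A * w))) Bu≡1+Aw)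
                    (solve (x₀ ⊗ x₁ ⊗ x₁ ⁻) x₀ refl (x ∷ pow x (A * w) ∷ [])))
    yᴬ-exponent : ∀ A B u → B * u * A ≡ A * B * u
    yᴬ-exponent = solve-∀
    zᴮ-exponent : ∀ A B w → A * w * B ≡ A * B * w
    zᴮ-exponent = solve-∀

  coprime-factor∈⟨product⟩ : ∀ {x z A B} .{{_ : NonZero B}} → Commute x z → Coprime B A →
                             pow x A ≡ e → pow z B ≡ e → ∃[ k ] pow (x · z) (suc k) ≡ x
  coprime-factor∈⟨product⟩ {x} {z} {A} {B} xz≡zx B⊥A xᴬ≡e zᴮ≡e with coprime⇒bézout B⊥A
  ... | u , w , Bu≡1+Aw = A * w , (begin
    pow (x · z) (1 + A * w)             ≡⟨ cong (pow (x · z)) Bu≡1+Aw ⟨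
    pow (x · z) (B * u)                 ≡⟨ pow-·-commute xz≡zx (B * u) ⟩
    pow x (B * u) · pow z (B * u)       ≡⟨ cong₂ _·_ (cong (pow x) Bu≡1+Aw) (pow-*-≡e {z} {B} zᴮ≡e u) ⟩
    (x · pow x (A * w)) · e             ≡⟨ cong (λ y → (x · y) · e) (pow-*-≡e {x} {A} xᴬ≡e w) ⟩
    (x · e) · e                         ≡⟨ trans (idʳ _) (idʳ x) ⟩
    x                                   ∎)
    where open ≡-Reasoning

  tuples : ℕ → List (List Element)
  tuples zero    = [] ∷ []
  tuples (suc k) = concatMap (λ g → map (g ∷_) (tuples k)) (allFin (n G))

  product : List Element → Element
  product []      = e
  product (g ∷ v) = g · product v

  infix 4 _≟ᵗ_
  _≟ᵗ_ : (v w : List Element) → Dec (v ≡ w)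
  _≟ᵗ_ = List.≡-dec Fin._≟_

  ∑-tuples-suc : ∀ k (f : List Element → ℕ) →
                 ∑ (tuples (suc k)) f ≡ ∑[ g ∈ allFin (n G) ] ∑[ v ∈ tuples k ] f (g ∷ v)
  ∑-tuples-suc k f =
    trans (∑-concatMap (allFin (n G)) _ f) (∑-cong (allFin (n G)) λ g → ∑-map (tuples k) (g ∷_) f)

  ∑-tuples-cong : ∀ k {f g : List Element → ℕ} → (∀ v → length v ≡ k → f v ≡ g v) →
                  ∑ (tuples k) f ≡ ∑ (tuples k) g
  ∑-tuples-cong zero    f≗g = cong (_+ 0) (f≗g [] refl)
  ∑-tuples-cong (suc k) {f} {g} f≗g = begin
    ∑ (tuples (suc k)) f                              ≡⟨ ∑-tuples-suc k f ⟩
    ∑[ x ∈ allFin (n G) ] ∑[ v ∈ tuples k ] f (x ∷ v)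
      ≡⟨ ∑-cong (allFin (n G)) (λ x → ∑-tuples-cong k λ v len → f≗g (x ∷ v) (cong suc len)) ⟩
    ∑[ x ∈ allFin (n G) ] ∑[ v ∈ tuples k ] g (x ∷ v)  ≡⟨ ∑-tuples-suc k g ⟨
    ∑ (tuples (suc k)) g                              ∎
    where open ≡-Reasoning

  ∑-tuples-𝟙 : ∀ k w → length w ≡ k → ∑[ v ∈ tuples k ] 𝟙 (w ≟ᵗ v) ≡ 1
  ∑-tuples-𝟙 zero    []      _   = refl
  ∑-tuples-𝟙 (suc k) (h ∷ w) len =
    trans (∑-tuples-suc k _) (trans (∑-cong (allFin (n G)) λ g → row g (h Fin.≟ g)) (∑-allFin-𝟙 h))
    where
    row : ∀ g (h≟g : Dec (h ≡ g)) → ∑[ v ∈ tuples k ] 𝟙 (h ∷ w ≟ᵗ g ∷ v) ≡ 𝟙 h≟g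
    row g (yes refl) =
      trans (∑-cong (tuples k) λ v → 𝟙-cong (h ∷ w ≟ᵗ h ∷ v) (w ≟ᵗ v) List.∷-injectiveʳ (cong (h ∷_)))
            (∑-tuples-𝟙 k w (suc-injective len))
    row g (no h≢g)   = ∑-≡0 (tuples k) λ v → 𝟙-no (h ∷ w ≟ᵗ g ∷ v) (h≢g ∘ List.∷-injectiveˡ)

  ∑-tuples-product : ∀ k c → ∑[ v ∈ tuples (suc k) ] 𝟙 (product v Fin.≟ c) ≡ n G ^ k
  ∑-tuples-product zero c = trans (∑-tuples-suc 0 _) (trans (∑-cong (allFin (n G)) row) (∑-allFin-𝟙 c))
    where
    row : ∀ g → 𝟙 (g · e Fin.≟ c) + 0 ≡ 𝟙 (c Fin.≟ g)
    row g = trans (+-identityʳ _)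
      (𝟙-cong (g · e Fin.≟ c) (c Fin.≟ g) (λ ge≡c → trans (sym ge≡c) (idʳ g)) (λ c≡g → trans (idʳ g) (sym c≡g)))
  ∑-tuples-product (suc k) c = begin
    ∑[ v ∈ tuples (2+ k) ] 𝟙 (product v Fin.≟ c)                            ≡⟨ ∑-tuples-suc (suc k) _ ⟩
    ∑[ g ∈ allFin (n G) ] ∑[ v ∈ tuples (suc k) ] 𝟙 (g · product v Fin.≟ c)  ≡⟨ ∑-cong (allFin (n G)) row ⟩
    ∑[ g ∈ allFin (n G) ] (n G ^ k)                                        ≡⟨ ∑-const (allFin (n G)) _ ⟩
    length (allFin (n G)) * n G ^ k
      ≡⟨ cong (_* n G ^ k) (List.length-tabulate {n = n G} (λ i → i)) ⟩
    n G * n G ^ k                                                         ∎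
    where
    open ≡-Reasoning
    row : ∀ g → ∑[ v ∈ tuples (suc k) ] 𝟙 (g · product v Fin.≟ c) ≡ n G ^ k
    row g = trans (∑-cong (tuples (suc k)) λ v → 𝟙-cong (g · product v Fin.≟ c) (product v Fin.≟ inv g · c)
                     (λ gp≡c → trans (solve x₁ (x₀ ⁻ ⊗ (x₀ ⊗ x₁)) refl (g ∷ product v ∷ [])) (cong (inv g ·_) gp≡c))
                     (λ p≡g⁻¹c → trans (cong (g ·_) p≡g⁻¹c) (solve (x₀ ⊗ (x₀ ⁻ ⊗ x₁)) x₁ refl (g ∷ c ∷ []))))
                  (∑-tuples-product k (inv g · c))

  product-++ : ∀ u w → product (u ++ w) ≡ product u · product w
  product-++ []      w = sym (idˡ (product w))
  product-++ (g ∷ u) w = trans (cong (g ·_) (product-++ u w)) (sym (assoc g _ _))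

  product-rotate : ∀ v → product v ≡ e → product (rotate v) ≡ e
  product-rotate []      ≡e = ≡e
  product-rotate (g ∷ w) gw≡e = begin
    product (w ∷ʳ g)         ≡⟨ product-++ w (g ∷ []) ⟩
    product w · (g · e)      ≡⟨ cong (product w ·_) (idʳ g) ⟩
    product w · g            ≡⟨ cong (_· g) (inverseʳ-unique g (product w) gw≡e) ⟩
    inv g · g                ≡⟨ invˡ g ⟩
    e                        ∎
    where open ≡-Reasoning

  product-replicate : ∀ k g → product (replicate k g) ≡ pow g k
  product-replicate zero    g = refl
  product-replicate (suc k) g = cong (g ·_) (product-replicate k g)

  cauchy : ∀ {q} → Prime q → q ∣ n G → ∃[ g ] g ≢ e × pow g q ≡ e
  cauchy {0}           ()
  cauchy {1}           ()
  cauchy {q@(2+ k)} q-prime q∣n = nontrivialConstant⇒element (∑>0⇒ (tuples q) (𝟙 ∘ NontrivialConstant?) ∑>0)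
    where
    open import Function.Endo.Propositional (List Element) using () renaming (_^_ to _^ᶠ_)
    open FreeOrbits _≟ᵗ_ rotate rotate-injective q-prime (tuples q)

    trivialTuple : List Element
    trivialTuple = replicate q e

    Moved : List Element → Set
    Moved v = length v ≡ q × product v ≡ e × rotate v ≢ v

    Moved? : ∀ v → Dec (Moved v)
    Moved? v = length v ℕ.≟ q ×-dec product v Fin.≟ e ×-dec ¬? (rotate v ≟ᵗ v)

    moved-free : IsFreeOrbitUnion Moved
    moved-free = record
      { closed       = λ { {v} (len , prod≡e , unfixed) →
                         trans (length-rotate v) len , product-rotate v prod≡e , unfixed ∘ rotate-injective }
      ; fixpointFree = λ (_ , _ , unfixed) → unfixed
      ; periodic     = λ { {v} (len , _) → subst (λ m → (rotate ^ᶠ m) v ≡ v) len (rotate-periodic v) }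
      ; listedOnce   = λ (len , _) → ∑-tuples-𝟙 q _ len
      }

    NontrivialConstant : List Element → Set
    NontrivialConstant v = length v ≡ q × (product v ≡ e × rotate v ≡ v) × trivialTuple ≢ v

    NontrivialConstant? : ∀ v → Dec (NontrivialConstant v)
    NontrivialConstant? v =
      length v ℕ.≟ q ×-dec (product v Fin.≟ e ×-dec rotate v ≟ᵗ v) ×-dec ¬? (trivialTuple ≟ᵗ v)

    -- McKay's count: a tuple with product e is moved by rotation, or trivial, or a nontrivial constant tuple.
    𝟙-product≡e : ∀ v → length v ≡ q →
                  𝟙 (product v Fin.≟ e) ≡ 𝟙 (Moved? v) + (𝟙 (NontrivialConstant? v) + 𝟙 (trivialTuple ≟ᵗ v))
    𝟙-product≡e v len = begin
      𝟙 P?                                              ≡⟨ 𝟙-split P? R? ⟩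
      𝟙 (P? ×-dec ¬? R?) + 𝟙 (P? ×-dec R?)
        ≡⟨ cong₂ _+_ (sym (𝟙-×-yes L? _ len)) (𝟙-split (P? ×-dec R?) O?) ⟩
      𝟙 (Moved? v) + (𝟙 ((P? ×-dec R?) ×-dec ¬? O?) + 𝟙 ((P? ×-dec R?) ×-dec O?))
        ≡⟨ cong (𝟙 (Moved? v) +_)
             (cong₂ _+_ (sym (𝟙-×-yes L? _ len)) (𝟙-cong _ O? proj₂ λ t≡v → trivial-fixed t≡v , t≡v)) ⟩
      𝟙 (Moved? v) + (𝟙 (NontrivialConstant? v) + 𝟙 O?)  ∎
      where
      open ≡-Reasoning
      L? = length v ℕ.≟ q
      P? = product v Fin.≟ e
      R? = rotate v ≟ᵗ v
      O? = trivialTuple ≟ᵗ v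
      trivial-fixed : trivialTuple ≡ v → product v ≡ e × rotate v ≡ v
      trivial-fixed refl = trans (product-replicate q e) (pow-e q) , rotate-replicate q e

    #Moved #NontrivialConstant : ℕ
    #Moved             = ∑[ v ∈ tuples q ] 𝟙 (Moved? v)
    #NontrivialConstant = ∑[ v ∈ tuples q ] 𝟙 (NontrivialConstant? v)

    nᵠ⁻¹≡ : n G ^ suc k ≡ #Moved + (#NontrivialConstant + 1)
    nᵠ⁻¹≡ = begin
      n G ^ suc k                                                    ≡⟨ ∑-tuples-product (suc k) e ⟨
      ∑[ v ∈ tuples q ] 𝟙 (product v Fin.≟ e)                        ≡⟨ ∑-tuples-cong q 𝟙-product≡e ⟩
      ∑[ v ∈ tuples q ] (𝟙 (Moved? v) + (𝟙 (NontrivialConstant? v) + 𝟙 (trivialTuple ≟ᵗ v)))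
        ≡⟨ ∑-+ (tuples q) _ _ ⟩
      #Moved + ∑[ v ∈ tuples q ] (𝟙 (NontrivialConstant? v) + 𝟙 (trivialTuple ≟ᵗ v))
        ≡⟨ cong (#Moved +_) (∑-+ (tuples q) _ _) ⟩
      #Moved + (#NontrivialConstant + ∑[ v ∈ tuples q ] 𝟙 (trivialTuple ≟ᵗ v))
        ≡⟨ cong (λ t → #Moved + (#NontrivialConstant + t)) (∑-tuples-𝟙 q trivialTuple (List.length-replicate q)) ⟩
      #Moved + (#NontrivialConstant + 1)                              ∎
      where open ≡-Reasoning

    q∣#NontrivialConstant+1 : q ∣ #NontrivialConstant + 1
    q∣#NontrivialConstant+1 =
      ∣m+n∣m⇒∣n (subst (q ∣_) nᵠ⁻¹≡ (∣m⇒∣m*n (n G ^ k) q∣n)) (freeOrbitUnion⇒∣count Moved? moved-free)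

    ∑>0 : 0 < #NontrivialConstant
    ∑>0 with #NontrivialConstant | q∣#NontrivialConstant+1
    ... | zero  | q∣1 = contradiction (∣1⇒≡1 q∣1) λ ()
    ... | suc _ | _   = z<s

    nontrivialConstant⇒element : (∃ λ v → 0 < 𝟙 (NontrivialConstant? v)) → ∃[ g ] g ≢ e × pow g q ≡ e
    nontrivialConstant⇒element (v , v-counted) with v | 𝟙>0⇒ (NontrivialConstant? v) v-counted
    ... | g ∷ w | len , (prod≡e , fixed) , trivial≢v = g , g≢e , gᵠ≡e
      where
      v≡gᵠ : g ∷ w ≡ replicate q g
      v≡gᵠ = trans (rotate-fixed⇒replicate g w fixed) (cong (λ m → replicate m g) len)
      g≢e : g ≢ e
      g≢e refl = trivial≢v (sym v≡gᵠ)
      gᵠ≡e : pow g q ≡ e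
      gᵠ≡e = trans (sym (product-replicate q g)) (trans (cong product (sym v≡gᵠ)) prod≡e)

  PrimePowerOrder : ℕ → Element → Set
  PrimePowerOrder s y = ∃[ α ] pow y (s ^ α) ≡ e

  CoprimeOrder : ℕ → Element → Set
  CoprimeOrder s z = ∃[ m ] pow z m ≡ e × Coprime m s

  PrimaryDecomposition : ℕ → Element → Set
  PrimaryDecomposition s x = ∃₂ λ y z → x ≡ y · z × PrimePowerOrder s y × CoprimeOrder s z

  primaryDecomposition : ∀ {s} → Prime s → ∀ x → PrimaryDecomposition s x
  primaryDecomposition {s} s-prime x =
    let k , xᵏ⁺¹≡e = finite-order x
        α , r , k+1≡sᵅr , s∤r = primePowerSplit s-prime (suc k)
        s⊥r = prime∤⇒coprime s-prime s∤r
        y , z , x≡yz , yˢ^α≡e , zʳ≡e =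
          coprimeSplit x {{∤⇒nonZero s∤r}} (coprime-^ˡ s⊥r α) (subst (λ m → pow x m ≡ e) k+1≡sᵅr xᵏ⁺¹≡e)
    in y , z , x≡yz , (α , yˢ^α≡e) , (r , zʳ≡e , Coprimality.sym s⊥r)

  primePowerOrder⇒coprimeOrder : ∀ {s t y} → Prime s → Prime t → s ≢ t → PrimePowerOrder s y → CoprimeOrder t y
  primePowerOrder⇒coprimeOrder {s} s-prime t-prime s≢t (α , yˢ^α≡e) =
    s ^ α , yˢ^α≡e , coprime-^ˡ (distinctPrimes⇒coprime s-prime t-prime s≢t) α

  ¬abelian⇒noncommuting : ¬ (∀ x z → Commute x z) → ∃₂ λ x z → ¬ Commute x z
  ¬abelian⇒noncommuting nonAbelian with Fin.¬∀⟶∃¬ (n G) _ (λ x → Fin.all? λ z → x · z Fin.≟ z · x) nonAbelian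
  ... | x , ¬∀z with Fin.¬∀⟶∃¬ (n G) _ (λ z → x · z Fin.≟ z · x) ¬∀z
  ...   | z , ¬xz = x , z , ¬xz

  ≈-isEquivalence : IsEquivalence (_≈_ (ProperPowerGraph G))
  ≈-isEquivalence = On.isEquivalence proj₁ isEquivalence

  module Nilpotent (nilpotent : IsNilpotent G) where

    primePowerOrder-coprimeOrder⇒commute : ∀ {s y z} → Prime s → PrimePowerOrder s y → CoprimeOrder s z → Commute y z
    primePowerOrder-coprimeOrder⇒commute s-prime (α , yˢ^α≡e) (m , zᵐ≡e , m⊥s) =
      coprime-exponents⇒commute nilpotent {{m^n≢0 _ α {{prime⇒nonZero s-prime}}}}
        (coprime-^ˡ (Coprimality.sym m⊥s) α) yˢ^α≡e zᵐ≡e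

    -- The s-part of a·b commutes with a and b, so its s′-part commutes with neither.
    thirdLeaf : ∀ {s a b} → Prime s → CoprimeOrder s a → CoprimeOrder s b → ¬ Commute a b →
                ∃[ c ] CoprimeOrder s c × ¬ Commute a c × ¬ Commute b c
    thirdLeaf {s} {a} {b} s-prime a-coprime b-coprime ¬ab = third (primaryDecomposition s-prime (a · b))
      where
      third : PrimaryDecomposition s (a · b) → ∃[ c ] CoprimeOrder s c × ¬ Commute a c × ¬ Commute b c
      third (d , c , ab≡dc , d-primary , c-coprime) = c , c-coprime , ¬ac , ¬bc
        where
        open ≡-Reasoning
        ad≡da : Commute a d
        ad≡da = sym (primePowerOrder-coprimeOrder⇒commute s-prime d-primary a-coprime)
        bd≡db : Commute b d
        bd≡db = sym (primePowerOrder-coprimeOrder⇒commute s-prime d-primary b-coprime)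
        ¬ac : ¬ Commute a c
        ¬ac ac≡ca = ¬ab (∙-cancelˡ a _ _ (begin
          a · (a · b)   ≡⟨ cong (a ·_) ab≡dc ⟩
          a · (d · c)   ≡⟨ commute-·ʳ ad≡da ac≡ca ⟩
          (d · c) · a   ≡⟨ cong (_· a) ab≡dc ⟨
          (a · b) · a   ≡⟨ assoc a b a ⟩
          a · (b · a)   ∎))
        ¬bc : ¬ Commute b c
        ¬bc bc≡cb = ¬ab (sym (∙-cancelʳ b _ _ (begin
          (b · a) · b   ≡⟨ assoc b a b ⟩
          b · (a · b)   ≡⟨ cong (b ·_) ab≡dc ⟩
          b · (d · c)   ≡⟨ commute-·ʳ bd≡db bc≡cb ⟩
          (d · c) · b   ≡⟨ cong (_· b) ab≡dc ⟨
          (a · b) · b   ∎)))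

    module ClawCentredAt {s} (s-prime : Prime s) {y} (y≢e : y ≢ e) (yˢ≡e : pow y s ≡ e) where
      instance _ = prime⇒nonZero s-prime

      commutes-with-y : ∀ {w} → CoprimeOrder s w → Commute w y
      commutes-with-y (m , wᵐ≡e , m⊥s) =
        coprime-exponents⇒commute nilpotent {{coprime-prime⇒nonZero s-prime m⊥s}} m⊥s wᵐ≡e yˢ≡e

      y∈⟨wy⟩ : ∀ {w} → CoprimeOrder s w → ∃[ k ] pow (w · y) (suc k) ≡ y
      y∈⟨wy⟩ w-coprime@(m , wᵐ≡e , m⊥s) =
        let yw≡wy = sym (commutes-with-y w-coprime)
            k , yw^k+1≡y = coprime-factor∈⟨product⟩ {{coprime-prime⇒nonZero s-prime m⊥s}} yw≡wy m⊥s yˢ≡e wᵐ≡e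
        in k , subst (λ g → pow g (suc k) ≡ y) yw≡wy yw^k+1≡y

      w∈⟨wy⟩ : ∀ {w} → CoprimeOrder s w → ∃[ k ] pow (w · y) (suc k) ≡ w
      w∈⟨wy⟩ w-coprime@(m , wᵐ≡e , m⊥s) =
        coprime-factor∈⟨product⟩ (commutes-with-y w-coprime) (Coprimality.sym m⊥s) wᵐ≡e yˢ≡e

      y-adjacent : ∀ {w} → CoprimeOrder s w → w ≢ e → PowAdj G y (w · y)
      y-adjacent w-coprime w≢e =
        (λ y≡wy → w≢e (sym (∙-cancelʳ y e _ (trans (idˡ y) y≡wy)))) , inj₂ (y∈⟨wy⟩ w-coprime)

      wy→w′y⇒commute : ∀ {w w′} → CoprimeOrder s w → CoprimeOrder s w′ →
                       ∃[ k ] pow (w · y) (suc k) ≡ w′ · y → Commute w w′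
      wy→w′y⇒commute {w} {w′} w-coprime w′-coprime (k , wy^k+1≡w′y) =
        let i , wy^i+1≡w = w∈⟨wy⟩ w-coprime
            j , w′y^j+1≡w′ = w∈⟨wy⟩ w′-coprime
            w′≡ = trans (sym w′y^j+1≡w′)
                    (trans (cong (λ g → pow g (suc j)) (sym wy^k+1≡w′y)) (sym (pow-* (w · y) (suc k) (suc j))))
        in subst₂ Commute wy^i+1≡w (sym w′≡) (pow-commute (w · y) (suc i) (suc k * suc j))

      ¬adjacent : ∀ {w w′} → CoprimeOrder s w → CoprimeOrder s w′ → ¬ Commute w w′ → ¬ PowAdj G (w · y) (w′ · y)
      ¬adjacent w-coprime w′-coprime ¬ww′ (_ , inj₁ wy→w′y) = ¬ww′ (wy→w′y⇒commute w-coprime w′-coprime wy→w′y)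
      ¬adjacent w-coprime w′-coprime ¬ww′ (_ , inj₂ w′y→wy) = ¬ww′ (sym (wy→w′y⇒commute w′-coprime w-coprime w′y→wy))

      distinct : ∀ {w w′} → ¬ Commute w w′ → w · y ≢ w′ · y
      distinct {w} ¬ww′ wy≡w′y = ¬ww′ (subst (λ v → w · v ≡ v · w) (∙-cancelʳ y _ _ wy≡w′y) refl)

      y-nonDominating : ∀ {a b} → CoprimeOrder s a → CoprimeOrder s b → ¬ Commute a b → ¬ Dominating G y
      y-nonDominating {a} {b} (m , aᵐ≡e , m⊥s) b-coprime ¬ab dominating = ¬y~a (dominating a y≢a)
        where
        y≢a : y ≢ a
        y≢a y≡a = ¬ab (subst (λ g → Commute g b) y≡a (sym (commutes-with-y b-coprime)))
        ¬y~a : ¬ PowAdj G y a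
        ¬y~a (_ , inj₁ (k , y^k+1≡a)) =
          ¬ab (sym (subst (Commute b) y^k+1≡a (commute-powʳ (commutes-with-y b-coprime) (suc k))))
        ¬y~a (_ , inj₂ (k , a^k+1≡y)) = y≢e (coprime-exponents⇒≡e {{coprime-prime⇒nonZero s-prime m⊥s}} m⊥s (begin
          pow y m                    ≡⟨ cong (λ g → pow g m) a^k+1≡y ⟨
          pow (pow a (suc k)) m      ≡⟨ pow-* a (suc k) m ⟨
          pow a (suc k * m)          ≡⟨ cong (pow a) (*-comm (suc k) m) ⟩
          pow a (m * suc k)          ≡⟨ pow-*-≡e {a} {m} aᵐ≡e (suc k) ⟩
          e                          ∎) yˢ≡e)
          where open ≡-Reasoning

      wy-nonDominating : ∀ {w w′} → CoprimeOrder s w → CoprimeOrder s w′ → ¬ Commute w w′ → ¬ Dominating G (w · y)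
      wy-nonDominating w-coprime w′-coprime ¬ww′ dominating =
        ¬adjacent w-coprime w′-coprime ¬ww′ (dominating _ (distinct ¬ww′))

      claw : (w : Fin 3 → Element) → (∀ i → CoprimeOrder s (w i)) → (∀ {i j} → i ≢ j → ¬ Commute (w i) (w j)) →
             Claw (ProperPowerGraph G)
      claw w coprime noncommuting = record
        { centre             = y , y-nonDominating (coprime 0F) (coprime 1F) (noncommuting λ ())
        ; leaf               = λ i →
            w i · y , wy-nonDominating (coprime i) (coprime (partner i)) (noncommuting (≢partner i))
        ; centre-adjacent    = λ i → y-adjacent (coprime i) (noncommuting⇒≢e (noncommuting (≢partner i)))
        ; leaves-nonadjacent = λ i≢j → ¬adjacent (coprime _) (coprime _) (noncommuting i≢j)
        ; leaves-distinct    = λ i≢j → distinct (noncommuting i≢j)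
        }
        where
        partner : Fin 3 → Fin 3
        partner 0F = 1F
        partner _  = 0F
        ≢partner : ∀ i → i ≢ partner i
        ≢partner 0F = λ ()
        ≢partner 1F = λ ()
        ≢partner 2F = λ ()
        noncommuting⇒≢e : ∀ {a b} → ¬ Commute a b → a ≢ e
        noncommuting⇒≢e {a} {b} ¬ab refl = ¬ab (sym (commute-eʳ b))

    noncommuting⇒¬lineGraph : ∀ {s a b} → Prime s → s ∣ n G → CoprimeOrder s a → CoprimeOrder s b →
                              ¬ Commute a b → ¬ (∃[ m ] ∃[ Γ ] (ProperPowerGraph G ≅ LineGraph {m} Γ))
    noncommuting⇒¬lineGraph {s} {a} {b} s-prime s∣n a-coprime b-coprime ¬ab (_ , Λ , iso) =
      let y , y≢e , yˢ≡e = cauchy s-prime s∣n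
          c , c-coprime , ¬ac , ¬bc = thirdLeaf s-prime a-coprime b-coprime ¬ab
          w : Fin 3 → Element
          w = λ { 0F → a ; 1F → b ; 2F → c }
          coprime : ∀ i → CoprimeOrder s (w i)
          coprime = λ { 0F → a-coprime ; 1F → b-coprime ; 2F → c-coprime }
          noncommuting : ∀ {i j} → i ≢ j → ¬ Commute (w i) (w j)
          noncommuting = λ
            { {0F} {0F} 0≢0 → contradiction refl 0≢0
            ; {0F} {1F} _   → ¬ab
            ; {0F} {2F} _   → ¬ac
            ; {1F} {0F} _   → ¬ab ∘ sym
            ; {1F} {1F} 1≢1 → contradiction refl 1≢1
            ; {1F} {2F} _   → ¬bc
            ; {2F} {0F} _   → ¬ac ∘ sym
            ; {2F} {1F} _   → ¬bc ∘ sym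
            ; {2F} {2F} 2≢2 → contradiction refl 2≢2
            }
      in ≅lineGraph⇒clawFree {Λ = Λ} ≈-isEquivalence iso (ClawCentredAt.claw s-prime y≢e yˢ≡e w coprime noncommuting)

    distinctPrimes⇒¬lineGraph : ∀ {p q x z} → Prime p → Prime q → p ≢ q → p ∣ n G → q ∣ n G → ¬ Commute x z →
                                ¬ (∃[ m ] ∃[ Γ ] (ProperPowerGraph G ≅ LineGraph {m} Γ))
    distinctPrimes⇒¬lineGraph {p} {q} {x} {z} p-prime q-prime p≢q p∣n q∣n ¬xz =
      split (primaryDecomposition q-prime x) (primaryDecomposition q-prime z)
      where
      split : PrimaryDecomposition q x → PrimaryDecomposition q z →
              ¬ (∃[ m ] ∃[ Γ ] (ProperPowerGraph G ≅ LineGraph {m} Γ))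
      split (x₁ , x₂ , x≡x₁x₂ , x₁-primary , x₂-coprime) (z₁ , z₂ , z≡z₁z₂ , z₁-primary , z₂-coprime)
        with x₂ · z₂ Fin.≟ z₂ · x₂
      ... | no ¬x₂z₂ = noncommuting⇒¬lineGraph q-prime q∣n x₂-coprime z₂-coprime ¬x₂z₂
      ... | yes x₂z₂ = noncommuting⇒¬lineGraph p-prime p∣n
            (primePowerOrder⇒coprimeOrder q-prime p-prime (p≢q ∘ sym) x₁-primary)
            (primePowerOrder⇒coprimeOrder q-prime p-prime (p≢q ∘ sym) z₁-primary) ¬x₁z₁
        where
        ¬x₁z₁ : ¬ Commute x₁ z₁
        ¬x₁z₁ x₁z₁ = ¬xz (subst₂ Commute (sym x≡x₁x₂) (sym z≡z₁z₂) (commute-·ˡ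
          (commute-·ʳ x₁z₁ (primePowerOrder-coprimeOrder⇒commute q-prime x₁-primary z₂-coprime))
          (commute-·ʳ (sym (primePowerOrder-coprimeOrder⇒commute q-prime z₁-primary x₂-coprime)) x₂z₂)))

mainTheorem16 : (G : FinGroup) → IsNilpotent G → ¬ IsAbelian G →
    HasExactlyTwoPrimeDivisors (n G) →
    ¬ (∃[ m ] ∃[ Γ ] (ProperPowerGraph G ≅ LineGraph {m} Γ))
-- Only two distinct prime divisors are needed.
mainTheorem16 G nilpotent nonAbelian (p , q , p≢q , p-prime , q-prime , p∣n , q∣n , _) =
  let x , z , ¬xz = ¬abelian⇒noncommuting nonAbelian
  in distinctPrimes⇒¬lineGraph p-prime q-prime p≢q p∣n q∣n ¬xz
  where
  open GroupTheory G
  open Nilpotent nilpotent
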